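{- Let $P$ be a finite atomic lattice. Then $P$ is super-atomic if and only if for every $p\in P\setminus(\mathrm{atoms}(P)\cup\{0\})$ there exist two atoms $p_1,p_2$ of $P$ with $p=p_1\vee p_2$ such that $\mathrm{supp}(p)\setminus\{p_1\}\in\mathcal{S}_P$ and $\mathrm{supp}(p)\setminus\{p_2\}\in\mathcal{S}_P$.
   Context: A finite atomic lattice is a finite lattice $P$ with least element $0$ and greatest element in which every nonzero element is a join of atoms; $\mathrm{atoms}(P)$ is its set of atoms, and $\mathrm{supp}(p)=\{a\in\mathrm{atoms}(P): a\le p\}$. Let $\mathcal{S}_P=\{\mathrm{supp}(p): p\in P\}$ (a family of subsets of $\mathrm{atoms}(P)$, which ordered by inclusion is a lattice isomorphic to $P$). For $p\in P$ let $B_p=\{T\subseteq\mathrm{supp}(p):\bigvee_{b\in T}b=p\}$. $P$ is called super-atomic if for every $p\in P\setminus(\mathrm{atoms}(P)\cup\{0\})$ and every $T\in B_p$ there exist exactly two elements $a,b\in T$ such that $a\vee b=p$. -}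

module Defs where

open import Level using (_⊔_)
open import Data.Product using (Σ; ∃; _×_; _,_)
open import Data.Sum using (_⊎_)
open import Data.List using (List; foldr)
open import Data.List.Relation.Unary.All using (All)
open import Relation.Nullary using (¬_)
open import Relation.Binary.Lattice.Bundles using (BoundedLattice)
import Data.List.Membership.Setoid as SetoidMembership

module LatticeNotions {c ℓ₁ ℓ₂} (L : BoundedLattice c ℓ₁ ℓ₂) where
  open BoundedLattice L
  open SetoidMembership setoid using (_∈_)

  ⋁ : List Carrier → Carrier
  ⋁ = foldr _∨_ ⊥

  Finite : Set (c ⊔ ℓ₁)
  Finite = Σ (List Carrier) λ xs → ∀ x → x ∈ xs

  Atom : Carrier → Set (c ⊔ ℓ₁ ⊔ ℓ₂)
  Atom a = (¬ a ≈ ⊥) × (∀ x → x ≤ a → (x ≈ ⊥) ⊎ (x ≈ a))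

  Atomic : Set (c ⊔ ℓ₁ ⊔ ℓ₂)
  Atomic = ∀ p → ¬ p ≈ ⊥ → Σ (List Carrier) λ T → All Atom T × (⋁ T ≈ p)

  FiniteAtomicLattice : Set (c ⊔ ℓ₁ ⊔ ℓ₂)
  FiniteAtomicLattice = Finite × Atomic

  InSupp : Carrier → Carrier → Set (c ⊔ ℓ₁ ⊔ ℓ₂)
  InSupp p a = Atom a × (a ≤ p)

  NonAtomNonZero : Carrier → Set (c ⊔ ℓ₁ ⊔ ℓ₂)
  NonAtomNonZero p = (¬ Atom p) × (¬ p ≈ ⊥)

  -- T ∈ B_p : T ⊆ supp(p) (T given as a finite list) and ⋁ T = p
  InB : Carrier → List Carrier → Set (c ⊔ ℓ₁ ⊔ ℓ₂)
  InB p T = All (InSupp p) T × (⋁ T ≈ p)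

  ExactlyTwoJoining : Carrier → List Carrier → Set (c ⊔ ℓ₁)
  ExactlyTwoJoining p T =
    Σ Carrier λ a → Σ Carrier λ b →
      (a ∈ T) × (b ∈ T) × (¬ a ≈ b) × (a ∨ b ≈ p) ×
      (∀ x y → x ∈ T → y ∈ T → x ∨ y ≈ p →
         ((x ≈ a) × (y ≈ b)) ⊎ ((x ≈ b) × (y ≈ a)))

  SuperAtomic : Set (c ⊔ ℓ₁ ⊔ ℓ₂)
  SuperAtomic = ∀ p → NonAtomNonZero p → ∀ T → InB p T → ExactlyTwoJoining p T

  -- supp(p) ∖ {r} ∈ 𝒮_P : some q has exactly these atoms below it
  SuppMinusInS : Carrier → Carrier → Set (c ⊔ ℓ₁ ⊔ ℓ₂)
  SuppMinusInS p r = Σ Carrier λ q → ∀ a → Atom a →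
    ((a ≤ q → (a ≤ p × ¬ a ≈ r)) × ((a ≤ p × ¬ a ≈ r) → a ≤ q))

  TwoAtomCondition : Set (c ⊔ ℓ₁ ⊔ ℓ₂)
  TwoAtomCondition = ∀ p → NonAtomNonZero p →
    Σ Carrier λ p₁ → Σ Carrier λ p₂ →
      Atom p₁ × Atom p₂ × (p ≈ p₁ ∨ p₂) ×
      SuppMinusInS p p₁ × SuppMinusInS p p₂

-- An atom a ≤ p is essential for p if it occurs in every T ∈ B_p. For an atom a ≤ p,
-- supp(p) ∖ {a} ∈ 𝒮_P holds exactly when a is essential: if q realises supp(p) ∖ {a},
-- a set T avoiding a has ⋁ T ≤ q < p; conversely, q := ⋁ {x ∧ p : a ≰ x ∧ p} contains
-- every atom of supp(p) but a, and a ≤ q would make p the join of the atoms below these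
-- meets, a member of B_p avoiding a. Both conditions of the theorem therefore say that
-- p = p₁ ∨ p₂ for essential atoms p₁ ≠ p₂. If that holds, every T ∈ B_p contains p₁ and
-- p₂, and any x, y ∈ T with x ∨ y = p form a set {x, y} ∈ B_p, so {x, y} = {p₁, p₂}.
-- If P is super-atomic and a ∨ b = p is the unique joining pair of some T ∈ B_p, then
-- for any T' ∈ B_p the joining pair of T' is also a joining pair of {a, b} ∪ T', hence
-- equals {a, b}: a and b lie in T'.
module Submission where

open import Defs
open import Data.List using (List; []; _∷_; _++_; map; filter)
open import Data.List.Relation.Unary.All as All using (All; []; _∷_)
open import Data.List.Relation.Unary.All.Properties as Allₚ using (++⁺)
open import Data.List.Relation.Unary.Any as Any using (Any; here; there)
import Data.List.Relation.Unary.Any.Properties as Anyₚ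
import Data.List.Membership.Setoid as SetoidMembership
import Data.List.Membership.Setoid.Properties as SetoidMembershipₚ
open import Data.Product using (Σ; _×_; _,_; proj₁; proj₂)
open import Data.Sum as Sum using (_⊎_; inj₁; inj₂)
open import Effect.Monad using (RawMonad)
open import Function using (_∘_; case_of_)
open import Level using (_⊔_)
open import Relation.Binary.Definitions using (_Respects_)
open import Relation.Binary.Lattice.Bundles using (BoundedLattice)
import Relation.Binary.Lattice.Properties.JoinSemilattice as JoinSemilatticeₚ
import Relation.Binary.Lattice.Properties.BoundedJoinSemilattice as BoundedJoinSemilatticeₚ
open import Relation.Nullary using (¬_; Dec; yes; no; ¬?; contradiction)
open import Relation.Nullary.Negation using (DoubleNegation; ¬¬-Monad)

module SuperAtomicity {c ℓ₁ ℓ₂} (L : BoundedLattice c ℓ₁ ℓ₂) where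
  open BoundedLattice L
  open LatticeNotions L
  open JoinSemilatticeₚ joinSemilattice using (∨-cong; ∨-comm; ∨-assoc)
  open BoundedJoinSemilatticeₚ boundedJoinSemilattice using (identityˡ; identityʳ)
  open SetoidMembership setoid using (_∈_)
  open SetoidMembershipₚ using (∈-resp-≈; ∈-filter⁺)
  open RawMonad (¬¬-Monad {c ⊔ ℓ₁ ⊔ ℓ₂}) using (pure; _>>=_)

  ⋁-least : ∀ {z} xs → All (_≤ z) xs → ⋁ xs ≤ z
  ⋁-least []       []           = minimum _
  ⋁-least (_ ∷ xs) (x≤z ∷ xs≤z) = ∨-least x≤z (⋁-least xs xs≤z)

  ⋁-upper : ∀ xs → All (_≤ ⋁ xs) xs
  ⋁-upper []       = []
  ⋁-upper (x ∷ xs) = x≤x∨y x _ ∷ All.map (λ y≤ → trans y≤ (y≤x∨y x _)) (⋁-upper xs)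

  ∈⇒≤⋁ : ∀ {x xs} → x ∈ xs → x ≤ ⋁ xs
  ∈⇒≤⋁ {xs = xs} = All.lookupₛ setoid (λ x≈y x≤ → trans (reflexive (Eq.sym x≈y)) x≤) (⋁-upper xs)

  ⋁-++ : ∀ xs {ys} → ⋁ (xs ++ ys) ≈ ⋁ xs ∨ ⋁ ys
  ⋁-++ []       = Eq.sym (identityˡ _)
  ⋁-++ (x ∷ xs) = Eq.trans (∨-cong Eq.refl (⋁-++ xs)) (Eq.sym (∨-assoc x _ _))

  AtomDecomposition : Carrier → Set (c ⊔ ℓ₁ ⊔ ℓ₂)
  AtomDecomposition y = Σ (List Carrier) λ T → All Atom T × ⋁ T ≈ y

  Essential : Carrier → Carrier → Set (c ⊔ ℓ₁ ⊔ ℓ₂)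
  Essential p a = ∀ T → InB p T → a ∈ T

  Atom-resp-≈ : Atom Respects _≈_
  Atom-resp-≈ x≈y (x≉⊥ , below-x) =
    (λ y≈⊥ → x≉⊥ (Eq.trans x≈y y≈⊥)) ,
    λ z z≤y → Sum.map₂ (λ z≈x → Eq.trans z≈x x≈y)
                       (below-x z (trans z≤y (reflexive (Eq.sym x≈y))))

  InSupp-resp-≈ : ∀ {p} → InSupp p Respects _≈_
  InSupp-resp-≈ x≈y (atom , x≤p) = Atom-resp-≈ x≈y atom , trans (reflexive (Eq.sym x≈y)) x≤p

  -- Decidable although _≈_ is not: a ∧ x lies below the atom a, so it is ⊥ or a.
  atom-≤? : ∀ {a} → Atom a → ∀ x → Dec (a ≤ x)
  atom-≤? {a} (a≉⊥ , below-a) x with below-a (a ∧ x) (x∧y≤x a x)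
  ... | inj₁ a∧x≈⊥ = no λ a≤x → a≉⊥ (antisym (trans (∧-greatest refl a≤x) (reflexive a∧x≈⊥)) (minimum a))
  ... | inj₂ a∧x≈a = yes (trans (reflexive (Eq.sym a∧x≈a)) (x∧y≤y a x))

  atom≤atom⇒≈ : ∀ {a b} → Atom a → Atom b → a ≤ b → a ≈ b
  atom≤atom⇒≈ (a≉⊥ , _) (_ , below-b) a≤b with below-b _ a≤b
  ... | inj₁ a≈⊥ = contradiction a≈⊥ a≉⊥
  ... | inj₂ a≈b = a≈b

  atom-≈? : ∀ {a b} → Atom a → Atom b → Dec (a ≈ b)
  atom-≈? {b = b} atom-a atom-b with atom-≤? atom-a b
  ... | yes a≤b = yes (atom≤atom⇒≈ atom-a atom-b a≤b)
  ... | no  a≰b = no (a≰b ∘ reflexive)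

  atom-∈⊎∉ : ∀ {a T} → Atom a → All Atom T → a ∈ T ⊎ All (λ t → ¬ t ≈ a) T
  atom-∈⊎∉ atom-a []               = inj₂ []
  atom-∈⊎∉ atom-a (atom-t ∷ atoms) with atom-≈? atom-t atom-a
  ... | yes t≈a = inj₁ (here (Eq.sym t≈a))
  ... | no  t≉a = Sum.map there (t≉a ∷_) (atom-∈⊎∉ atom-a atoms)

  atomDecomposition⇒InB : ∀ {p T} → All Atom T → ⋁ T ≈ p → InB p T
  atomDecomposition⇒InB {T = T} atoms ⋁T≈p =
    All.zipWith (λ (atom , t≤⋁T) → atom , trans t≤⋁T (reflexive ⋁T≈p)) (atoms , ⋁-upper T) ,
    ⋁T≈p

  atomic-≤ : Atomic → ∀ {p q} → ¬ p ≈ ⊥ → (∀ t → InSupp p t → t ≤ q) → p ≤ q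
  atomic-≤ atomic p≉⊥ supp≤q with atomic _ p≉⊥
  ... | T , atoms , ⋁T≈p =
    trans (reflexive (Eq.sym ⋁T≈p))
          (⋁-least T (All.map (supp≤q _) (proj₁ (atomDecomposition⇒InB atoms ⋁T≈p))))

  -- y ≈ ⊥ need not be decidable, so the empty decomposition of ⊥ is only
  -- available under double negation.
  atomDecomposition-¬¬ : Atomic → ∀ y → DoubleNegation (AtomDecomposition y)
  atomDecomposition-¬¬ atomic y ¬dec = ¬dec (atomic y λ y≈⊥ → ¬dec ([] , [] , Eq.sym y≈⊥))

  atomRefinement-¬¬ : Atomic → ∀ ys → DoubleNegation (Σ (List Carrier) λ T →
    All Atom T × All (λ t → Any (t ≤_) ys) T × ⋁ T ≈ ⋁ ys)
  atomRefinement-¬¬ atomic []       = pure ([] , [] , [] , Eq.refl)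
  atomRefinement-¬¬ atomic (y ∷ ys) = do
    (T₁ , atoms₁ , ⋁T₁≈y) ← atomDecomposition-¬¬ atomic y
    (T₂ , atoms₂ , refines₂ , ⋁T₂≈⋁ys) ← atomRefinement-¬¬ atomic ys
    pure (T₁ ++ T₂ ,
          ++⁺ atoms₁ atoms₂ ,
          ++⁺ (All.map (λ t≤⋁T₁ → here (trans t≤⋁T₁ (reflexive ⋁T₁≈y))) (⋁-upper T₁))
              (All.map there refines₂) ,
          Eq.trans (⋁-++ T₁) (∨-cong ⋁T₁≈y ⋁T₂≈⋁ys))

  suppMinusInS⇒essential : ∀ {p a} → Atom a → a ≤ p → SuppMinusInS p a → Essential p a
  suppMinusInS⇒essential atom-a a≤p (q , supp-q) T (T⊆supp , ⋁T≈p)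
    with atom-∈⊎∉ atom-a (All.map proj₁ T⊆supp)
  ... | inj₁ a∈T = a∈T
  ... | inj₂ T≉a = contradiction Eq.refl (proj₂ (proj₁ (supp-q _ atom-a) a≤q))
    where
    T≤q : All (_≤ q) T
    T≤q = All.zipWith (λ ((atom , t≤p) , t≉a) → proj₂ (supp-q _ atom) (t≤p , t≉a)) (T⊆supp , T≉a)
    a≤q : _ ≤ q
    a≤q = trans a≤p (trans (reflexive (Eq.sym ⋁T≈p)) (⋁-least T T≤q))

  essential⇒¬≤⋁-avoiding : Atomic → ∀ {p a ys} → Essential p a →
    All (_≤ p) ys → All (λ y → ¬ a ≤ y) ys → ¬ p ≤ ⋁ ys
  essential⇒¬≤⋁-avoiding atomic {p} {a} {ys} essential ys≤p ys≱a p≤⋁ys =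
    atomRefinement-¬¬ atomic ys λ (T , atoms , refines , ⋁T≈⋁ys) →
      a∉ T refines (essential T (T⊆supp atoms refines , ⋁T≈p T ⋁T≈⋁ys))
    where
    ⋁T≈p : ∀ T → ⋁ T ≈ ⋁ ys → ⋁ T ≈ p
    ⋁T≈p _ ⋁T≈⋁ys = Eq.trans ⋁T≈⋁ys (antisym (⋁-least ys ys≤p) p≤⋁ys)
    T⊆supp : ∀ {T} → All Atom T → All (λ t → Any (t ≤_) ys) T → All (InSupp p) T
    T⊆supp atoms refines = All.zipWith below-some-y (atoms , refines)
      where
      below-some-y : ∀ {t} → Atom t × Any (t ≤_) ys → InSupp p t
      below-some-y (atom , t≤y) with All.lookupAny ys≤p t≤y
      ... | y≤p , t≤y' = atom , trans t≤y' y≤p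
    a∉ : ∀ T → All (λ t → Any (t ≤_) ys) T → ¬ a ∈ T
    a∉ T refines a∈T with All.lookupAny refines a∈T
    ... | t≤y , a≈t with All.lookupAny ys≱a t≤y
    ...   | a≰y , t≤y' = a≰y (trans (reflexive a≈t) t≤y')

  meetsAvoiding : ∀ {a} → Atom a → Carrier → List Carrier → List Carrier
  meetsAvoiding atom-a p xs = filter (λ y → ¬? (atom-≤? atom-a y)) (map (_∧ p) xs)

  module _ {a} (atom-a : Atom a) (p : Carrier) (xs : List Carrier) where

    meetsAvoiding-≤ : All (_≤ p) (meetsAvoiding atom-a p xs)
    meetsAvoiding-≤ = Allₚ.filter⁺ _ (Allₚ.map⁺ (All.universal (λ x → x∧y≤y x p) xs))

    meetsAvoiding-≱ : All (λ y → ¬ a ≤ y) (meetsAvoiding atom-a p xs)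
    meetsAvoiding-≱ = Allₚ.all-filter _ (map (_∧ p) xs)

    meetsAvoiding-∈ : ∀ {x} → x ∈ xs → x ≤ p → ¬ a ≤ x → x ∈ meetsAvoiding atom-a p xs
    meetsAvoiding-∈ x∈xs x≤p a≰x =
      ∈-filter⁺ setoid _ (λ x≈y a≰x a≤y → a≰x (trans a≤y (reflexive (Eq.sym x≈y))))
        (Anyₚ.map⁺ (Any.map x≈x∧p x∈xs)) a≰x
      where
      x≈x∧p : ∀ {y} → _ ≈ y → _ ≈ y ∧ p
      x≈x∧p x≈y = antisym (∧-greatest (reflexive x≈y) x≤p) (trans (x∧y≤x _ p) (reflexive (Eq.sym x≈y)))

  essential⇒suppMinusInS : Finite → Atomic → ∀ {p a} → ¬ p ≈ ⊥ → Atom a → a ≤ p →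
    Essential p a → SuppMinusInS p a
  essential⇒suppMinusInS (xs , complete) atomic {p} {a} p≉⊥ atom-a a≤p essential =
    ⋁ ys , λ t atom-t → (λ t≤q → trans t≤q q≤p , λ t≈a → a≰q (trans (reflexive (Eq.sym t≈a)) t≤q)) ,
                        (λ (t≤p , t≉a) → supp∖a≤q atom-t t≤p t≉a)
    where
    ys : List Carrier
    ys = meetsAvoiding atom-a p xs
    q≤p : ⋁ ys ≤ p
    q≤p = ⋁-least ys (meetsAvoiding-≤ atom-a p xs)
    supp∖a≤q : ∀ {t} → Atom t → t ≤ p → ¬ t ≈ a → t ≤ ⋁ ys
    supp∖a≤q atom-t t≤p t≉a =
      ∈⇒≤⋁ (meetsAvoiding-∈ atom-a p xs (complete _) t≤p (t≉a ∘ Eq.sym ∘ atom≤atom⇒≈ atom-a atom-t))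
    a≰q : ¬ a ≤ ⋁ ys
    a≰q a≤q = essential⇒¬≤⋁-avoiding atomic essential
      (meetsAvoiding-≤ atom-a p xs) (meetsAvoiding-≱ atom-a p xs)
      (atomic-≤ atomic p≉⊥ λ t (atom-t , t≤p) → case atom-≈? atom-t atom-a of λ where
        (yes t≈a) → trans (reflexive t≈a) a≤q
        (no t≉a)  → supp∖a≤q atom-t t≤p t≉a)

  ∈-pair : ∀ {z x y} → z ∈ x ∷ y ∷ [] → z ≈ x ⊎ z ≈ y
  ∈-pair (here z≈x)         = inj₁ z≈x
  ∈-pair (there (here z≈y)) = inj₂ z≈y

  pair-InB : ∀ {p x y} → InSupp p x → InSupp p y → x ∨ y ≈ p → InB p (x ∷ y ∷ [])
  pair-InB x∈supp y∈supp x∨y≈p =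
    x∈supp ∷ y∈supp ∷ [] , Eq.trans (∨-cong Eq.refl (identityʳ _)) x∨y≈p

  joiningPair-unique : ∀ {p U x y u v} → ExactlyTwoJoining p U →
    x ∈ U → y ∈ U → x ∨ y ≈ p → u ∈ U → v ∈ U → u ∨ v ≈ p → u ≈ x ⊎ u ≈ y
  joiningPair-unique (_ , _ , _ , _ , _ , _ , unique) x∈U y∈U x∨y≈p u∈U v∈U u∨v≈p
    with unique _ _ u∈U v∈U u∨v≈p | unique _ _ x∈U y∈U x∨y≈p
  ... | inj₁ (u≈a , _) | inj₁ (x≈a , _) = inj₁ (Eq.trans u≈a (Eq.sym x≈a))
  ... | inj₁ (u≈a , _) | inj₂ (_ , y≈a) = inj₂ (Eq.trans u≈a (Eq.sym y≈a))
  ... | inj₂ (u≈b , _) | inj₁ (_ , y≈b) = inj₂ (Eq.trans u≈b (Eq.sym y≈b))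
  ... | inj₂ (u≈b , _) | inj₂ (x≈b , _) = inj₁ (Eq.trans u≈b (Eq.sym x≈b))

  superAtomic⇒essential : SuperAtomic → ∀ {p a b} → NonAtomNonZero p →
    Atom a → Atom b → a ∨ b ≈ p → Essential p a
  superAtomic⇒essential superAtomic {p} {a} {b} p∈ atom-a atom-b a∨b≈p T (T⊆supp , ⋁T≈p)
    with superAtomic p p∈ T (T⊆supp , ⋁T≈p)
  ... | x , y , x∈T , y∈T , _ , x∨y≈p , _ =
    Sum.[ (λ a≈x → ∈-resp-≈ setoid (Eq.sym a≈x) x∈T) , (λ a≈y → ∈-resp-≈ setoid (Eq.sym a≈y) y∈T) ]
      (joiningPair-unique (superAtomic p p∈ (a ∷ b ∷ T) ab∪T∈B)
        (there (there x∈T)) (there (there y∈T)) x∨y≈p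
        (here Eq.refl) (there (here Eq.refl)) a∨b≈p)
    where
    a∨b≤p : a ∨ b ≤ p
    a∨b≤p = reflexive a∨b≈p
    ab∪T∈B : InB p (a ∷ b ∷ T)
    ab∪T∈B =
      (atom-a , trans (x≤x∨y a b) a∨b≤p) ∷ (atom-b , trans (y≤x∨y a b) a∨b≤p) ∷ T⊆supp ,
      antisym (∨-least (trans (x≤x∨y a b) a∨b≤p) (∨-least (trans (y≤x∨y a b) a∨b≤p) (reflexive ⋁T≈p)))
              (trans (reflexive (Eq.sym ⋁T≈p)) (trans (y≤x∨y b _) (y≤x∨y a _)))

  essentialPair⇒exactlyTwoJoining : ∀ {p p₁ p₂} → NonAtomNonZero p → Atom p₁ →
    p ≈ p₁ ∨ p₂ → Essential p p₁ → Essential p p₂ → ∀ T → InB p T → ExactlyTwoJoining p T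
  essentialPair⇒exactlyTwoJoining {p} {p₁} {p₂} (p-nonatom , _) atom₁ p≈p₁∨p₂ essential₁ essential₂ T T∈B =
    p₁ , p₂ , essential₁ T T∈B , essential₂ T T∈B , p₁≉p₂ , Eq.sym p≈p₁∨p₂ , unique
    where
    p₁≉p₂ : ¬ p₁ ≈ p₂
    p₁≉p₂ p₁≈p₂ = p-nonatom (Atom-resp-≈ (antisym p₁≤p p≤p₁) atom₁)
      where
      p₁≤p : p₁ ≤ p
      p₁≤p = trans (x≤x∨y p₁ p₂) (reflexive (Eq.sym p≈p₁∨p₂))
      p≤p₁ : p ≤ p₁
      p≤p₁ = trans (reflexive p≈p₁∨p₂) (∨-least refl (reflexive (Eq.sym p₁≈p₂)))
    unique : ∀ x y → x ∈ T → y ∈ T → x ∨ y ≈ p → ((x ≈ p₁) × (y ≈ p₂)) ⊎ ((x ≈ p₂) × (y ≈ p₁))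
    unique x y x∈T y∈T x∨y≈p
      with ∈-pair (essential₁ _ xy∈B) | ∈-pair (essential₂ _ xy∈B)
      where
      xy∈B : InB p (x ∷ y ∷ [])
      xy∈B = pair-InB (All.lookupₛ setoid InSupp-resp-≈ (proj₁ T∈B) x∈T)
                      (All.lookupₛ setoid InSupp-resp-≈ (proj₁ T∈B) y∈T) x∨y≈p
    ... | inj₁ p₁≈x | inj₁ p₂≈x = contradiction (Eq.trans p₁≈x (Eq.sym p₂≈x)) p₁≉p₂
    ... | inj₁ p₁≈x | inj₂ p₂≈y = inj₁ (Eq.sym p₁≈x , Eq.sym p₂≈y)
    ... | inj₂ p₁≈y | inj₁ p₂≈x = inj₂ (Eq.sym p₂≈x , Eq.sym p₁≈y)
    ... | inj₂ p₁≈y | inj₂ p₂≈y = contradiction (Eq.trans p₁≈y (Eq.sym p₂≈y)) p₁≉p₂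

  twoAtomCondition⇒superAtomic : TwoAtomCondition → SuperAtomic
  twoAtomCondition⇒superAtomic twoAtom p p∈ with twoAtom p p∈
  ... | p₁ , p₂ , atom₁ , atom₂ , p≈p₁∨p₂ , supp∖p₁ , supp∖p₂ =
    essentialPair⇒exactlyTwoJoining p∈ atom₁ p≈p₁∨p₂
      (suppMinusInS⇒essential atom₁ (trans (x≤x∨y p₁ p₂) p₁∨p₂≤p) supp∖p₁)
      (suppMinusInS⇒essential atom₂ (trans (y≤x∨y p₁ p₂) p₁∨p₂≤p) supp∖p₂)
    where
    p₁∨p₂≤p : p₁ ∨ p₂ ≤ p
    p₁∨p₂≤p = reflexive (Eq.sym p≈p₁∨p₂)

  superAtomic⇒twoAtomCondition : FiniteAtomicLattice → SuperAtomic → TwoAtomCondition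
  superAtomic⇒twoAtomCondition (finite , atomic) superAtomic p p∈@(_ , p≉⊥)
    with atomic p p≉⊥
  ... | T , atoms , ⋁T≈p with superAtomic p p∈ T (atomDecomposition⇒InB atoms ⋁T≈p)
  ... | a , b , a∈T , b∈T , _ , a∨b≈p , _ =
    a , b , atom-a , atom-b , Eq.sym a∨b≈p ,
    essential⇒suppMinusInS finite atomic p≉⊥ atom-a (trans (x≤x∨y a b) (reflexive a∨b≈p))
      (superAtomic⇒essential superAtomic p∈ atom-a atom-b a∨b≈p) ,
    essential⇒suppMinusInS finite atomic p≉⊥ atom-b (trans (y≤x∨y a b) (reflexive a∨b≈p))
      (superAtomic⇒essential superAtomic p∈ atom-b atom-a (Eq.trans (∨-comm b a) a∨b≈p))
    where
    atom-a : Atom a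
    atom-a = All.lookupₛ setoid Atom-resp-≈ atoms a∈T
    atom-b : Atom b
    atom-b = All.lookupₛ setoid Atom-resp-≈ atoms b∈T

theorem4p1 : ∀ {c ℓ₁ ℓ₂} (L : BoundedLattice c ℓ₁ ℓ₂) →
    LatticeNotions.FiniteAtomicLattice L →
    (LatticeNotions.SuperAtomic L → LatticeNotions.TwoAtomCondition L) ×
    (LatticeNotions.TwoAtomCondition L → LatticeNotions.SuperAtomic L)
theorem4p1 L finiteAtomic =
  superAtomic⇒twoAtomCondition finiteAtomic , twoAtomCondition⇒superAtomic
  where open SuperAtomicity L
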